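{- Let $Q$ be a finite set, let $M\subseteq Q^5$ be an MDS code with code distance $4$, and let $M'\subseteq Q^4$ be the projection of $M$ in one coordinate direction. Then there exists an MDS code $C\subseteq Q^4$ with code distance $2$ such that $M'\subseteq C$.
   Context: For $0\le t\le d$, a $t$-dimensional axis-aligned plane in $Q^d$ is a set obtained by fixing $d-t$ coordinates and letting the other $t$ range over $Q$. A set $C\subseteq Q^d$ is an MDS code with code distance $t+1$ if $|C\cap\Gamma|=1$ for every $t$-dimensional axis-aligned plane $\Gamma$. The projection of $C\subseteq Q^d$ in the $i$-th direction is $\{(x_1,\dots,x_{i-1},x_{i+1},\dots,x_d) : \exists x_i,\ (x_1,\dots,x_d)\in C\}\subseteq Q^{d-1}$. -}

module Defs where

open import Data.Nat using (ℕ; suc)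
open import Data.Fin using (Fin)
open import Data.Fin.Subset using (Subset; _∉_; ∣_∣)
open import Data.Vec using (Vec; lookup; removeAt)
open import Data.Product using (Σ; ∃; _×_; _,_)
open import Relation.Binary.PropositionalEquality using (_≡_)
open import Relation.Unary using (Pred; _⊆_)
open import Level using (0ℓ)

-- Q is represented as Fin q; points of Q^d are vectors of length d.
Word : ℕ → ℕ → Set
Word q d = Vec (Fin q) d

Code : ℕ → ℕ → Set₁
Code q d = Pred (Word q d) 0ℓ

-- The axis-aligned plane with free coordinate set S through the point a:
-- coordinates outside S are fixed to those of a, coordinates in S range over Q.
-- Its dimension is ∣ S ∣.
InPlane : ∀ {q d} → Subset d → Word q d → Word q d → Set
InPlane S a x = ∀ i → i ∉ S → lookup x i ≡ lookup a i

MeetsExactlyOnce : ∀ {q d} → Code q d → Subset d → Word q d → Set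
MeetsExactlyOnce C S a =
  Σ (Word _ _) λ x → (C x × InPlane S a x) ×
    (∀ y → C y → InPlane S a y → y ≡ x)

-- C is an MDS code with code distance t+1: meets every t-dimensional
-- axis-aligned plane in exactly one point.
IsMDS : ∀ {q d} → (t : ℕ) → Code q d → Set
IsMDS {q} {d} t C = ∀ (S : Subset d) (a : Word q d) → ∣ S ∣ ≡ t → MeetsExactlyOnce C S a

projection : ∀ {q d} → Fin (suc d) → Code q (suc d) → Code q d
projection {q} i C y = ∃ λ (x : Word q _) → C x × removeAt x i ≡ y

-- An MDS code M ⊆ Q⁵ of distance 4 meets every 3-dimensional plane once;
-- equivalently, any two coordinates of a codeword determine it uniquely.
-- Hence for pairwise distinct coordinates A, B, I the map
--   (va , vb) ↦ I-th entry of the codeword with entries va at A and vb at B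
-- is a latin square.  Deleting coordinate i, let the remaining coordinates
-- of Q⁴ sit at positions e₀ … e₃ of Q⁵ and let f, g be the latin squares
-- read off at i from the pairs (e₁ , e₂) and (e₀ , e₃).  The code
--   C = { y ∈ Q⁴ ∣ f (y₁ , y₂) ≡ g (y₀ , y₃) }
-- contains the projection (both sides equal the deleted entry x_i of the
-- codeword x), and it meets every line once because each latin square can be
-- solved uniquely for either argument.
module Submission where

open import Defs
open import Data.Nat using (ℕ; suc; pred; _∸_)
open import Data.Fin using (Fin; zero; suc; _≟_; punchIn; #_)
open import Data.Fin.Properties using (punchInᵢ≢i; punchIn-injective; punchOut-punchIn)
open import Data.Fin.Subset
  using (Subset; inside; outside; ⊥; ⁅_⁆; _∪_; ∁; ∣_∣; _∉_)
open import Data.Fin.Subset.Properties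
  using ( ∣⁅x⁆∣≡1; ∪-identityˡ; ∪-identityʳ; ∣∁p∣≡n∸∣p∣; x∉∁p⇒x∈p; x∈p⇒x∉∁p
        ; x∈p∪q⁻; x∈p∪q⁺; x∈⁅x⁆; x∈⁅y⁆⇒x≡y; x≢y⇒x∉⁅y⁆; x∉⁅y⁆⇒x≢y)
open import Data.Vec using (Vec; _∷_; []; lookup; removeAt; replicate; tabulate; _[_]≔_)
open import Data.Vec.Properties
  using (tabulate∘lookup; tabulate-cong; lookup∘update; lookup∘update′; lookup-replicate; removeAt-punchOut)
open import Data.Product using (Σ; ∃; ∃!; _×_; _,_; proj₁; proj₂)
open import Data.Sum using (inj₁; inj₂)
open import Function using (_∘_)
open import Relation.Nullary using (yes; no; contradiction)
open import Relation.Unary using (_⊆_)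
open import Relation.Binary.PropositionalEquality

∃!-map : ∀ {A : Set} {P R : A → Set} →
         (∀ {v} → P v → R v) → (∀ {v} → R v → P v) → ∃! _≡_ P → ∃! _≡_ R
∃!-map to from (v , pv , unique) = v , to pv , λ rw → unique (from rw)

lookup-ext : ∀ {A : Set} {n} (xs ys : Vec A n) → (∀ k → lookup xs k ≡ lookup ys k) → xs ≡ ys
lookup-ext xs ys same = begin
  xs                  ≡⟨ sym (tabulate∘lookup xs) ⟩
  tabulate (lookup xs) ≡⟨ tabulate-cong same ⟩
  tabulate (lookup ys) ≡⟨ tabulate∘lookup ys ⟩
  ys                  ∎
  where open ≡-Reasoning

lookup-removeAt : ∀ {A : Set} {n} (x : Vec A (suc n)) i k →
                  lookup (removeAt x i) k ≡ lookup x (punchIn i k)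
lookup-removeAt x i k =
  trans (cong (lookup (removeAt x i)) (sym (punchOut-punchIn i)))
        (removeAt-punchOut x (punchInᵢ≢i i k ∘ sym))

freeExcept : ∀ {d} → Fin d → Fin d → Subset d
freeExcept A B = ∁ (⁅ A ⁆ ∪ ⁅ B ⁆)

∣⁅x⁆∪⁅y⁆∣≡2 : ∀ {n} (x y : Fin n) → x ≢ y → ∣ ⁅ x ⁆ ∪ ⁅ y ⁆ ∣ ≡ 2
∣⁅x⁆∪⁅y⁆∣≡2 zero    zero    x≢y = contradiction refl x≢y
∣⁅x⁆∪⁅y⁆∣≡2 zero    (suc y) _   = cong suc (trans (cong ∣_∣ (∪-identityˡ ⁅ y ⁆)) (∣⁅x⁆∣≡1 y))
∣⁅x⁆∪⁅y⁆∣≡2 (suc x) zero    _   = cong suc (trans (cong ∣_∣ (∪-identityʳ ⁅ x ⁆)) (∣⁅x⁆∣≡1 x))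
∣⁅x⁆∪⁅y⁆∣≡2 (suc x) (suc y) x≢y = ∣⁅x⁆∪⁅y⁆∣≡2 x y (x≢y ∘ cong suc)

∣freeExcept∣ : ∀ {d} {A B : Fin d} → A ≢ B → ∣ freeExcept A B ∣ ≡ d ∸ 2
∣freeExcept∣ {d} {A} {B} A≢B =
  trans (∣∁p∣≡n∸∣p∣ (⁅ A ⁆ ∪ ⁅ B ⁆)) (cong (d ∸_) (∣⁅x⁆∪⁅y⁆∣≡2 A B A≢B))

fixedˡ : ∀ {d} (A B : Fin d) → A ∉ freeExcept A B
fixedˡ A B = x∈p⇒x∉∁p (x∈p∪q⁺ (inj₁ (x∈⁅x⁆ A)))

fixedʳ : ∀ {d} (A B : Fin d) → B ∉ freeExcept A B
fixedʳ A B = x∈p⇒x∉∁p (x∈p∪q⁺ (inj₂ (x∈⁅x⁆ B)))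

inPlane-freeExcept : ∀ {q d} {A B : Fin d} (a x : Word q d) →
  lookup x A ≡ lookup a A → lookup x B ≡ lookup a B → InPlane (freeExcept A B) a x
inPlane-freeExcept {A = A} {B} _ _ xA xB k k∉free with x∈p∪q⁻ ⁅ A ⁆ ⁅ B ⁆ (x∉∁p⇒x∈p k∉free)
... | inj₁ k∈⁅A⁆ rewrite x∈⁅y⁆⇒x≡y A k∈⁅A⁆ = xA
... | inj₂ k∈⁅B⁆ rewrite x∈⁅y⁆⇒x≡y B k∈⁅B⁆ = xB

TwoDetermined : ∀ {q d} → Code q d → Set
TwoDetermined {q} {d} M = ∀ {A B : Fin d} → A ≢ B → ∀ va vb →
  ∃! _≡_ (λ x → M x × lookup x A ≡ va × lookup x B ≡ vb)

wordWith : ∀ {q d} {A B : Fin d} → A ≢ B → (va vb : Fin q) →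
           Σ (Word q d) λ a → lookup a A ≡ va × lookup a B ≡ vb
wordWith {d = d} {A} {B} A≢B va vb =
  replicate d va [ B ]≔ vb ,
  trans (lookup∘update′ A≢B (replicate d va) vb) (lookup-replicate A va) ,
  lookup∘update B (replicate d va) vb

-- An MDS code meeting every (d-2)-dimensional plane once is two-determined:
-- apply the definition to the plane fixing A and B through a word with
-- entries va at A and vb at B.
mds⇒twoDetermined : ∀ {q d} {M : Code q d} → IsMDS (d ∸ 2) M → TwoDetermined M
mds⇒twoDetermined mds {A} {B} A≢B va vb with wordWith A≢B va vb
... | a , aA , aB with mds (freeExcept A B) a (∣freeExcept∣ A≢B)
... | x , (x∈M , x∈Γ) , unique =
  x , (x∈M , trans (x∈Γ A (fixedˡ A B)) aA , trans (x∈Γ B (fixedʳ A B)) aB) ,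
  λ {y} (y∈M , yA , yB) →
    sym (unique y y∈M (inPlane-freeExcept a y (trans yA (sym aA)) (trans yB (sym aB))))

MeetsEveryLine : ∀ {q d} → Code q d → Set
MeetsEveryLine {q} {d} C = ∀ (k : Fin d) (a : Word q d) → ∃! _≡_ (λ v → C (a [ k ]≔ v))

∣p∣≡0⇒p≡⊥ : ∀ {n} (p : Subset n) → ∣ p ∣ ≡ 0 → p ≡ ⊥
∣p∣≡0⇒p≡⊥ []            _     = refl
∣p∣≡0⇒p≡⊥ (outside ∷ p) ∣p∣≡0 = cong (outside ∷_) (∣p∣≡0⇒p≡⊥ p ∣p∣≡0)

∣p∣≡1⇒singleton : ∀ {n} (p : Subset n) → ∣ p ∣ ≡ 1 → ∃ λ k → p ≡ ⁅ k ⁆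
∣p∣≡1⇒singleton (inside  ∷ p) ∣p∣≡1 = zero , cong (inside ∷_) (∣p∣≡0⇒p≡⊥ p (cong pred ∣p∣≡1))
∣p∣≡1⇒singleton (outside ∷ p) ∣p∣≡1 with ∣p∣≡1⇒singleton p ∣p∣≡1
... | k , refl = suc k , refl

update-onLine : ∀ {q d} (k : Fin d) (a : Word q d) v → InPlane ⁅ k ⁆ a (a [ k ]≔ v)
update-onLine k a v j j∉⁅k⁆ = lookup∘update′ (x∉⁅y⁆⇒x≢y j∉⁅k⁆) a v

onLine⇒update : ∀ {q d} {k : Fin d} {a y : Word q d} →
  InPlane ⁅ k ⁆ a y → y ≡ a [ k ]≔ lookup y k
onLine⇒update {k = k} {a} {y} y∈ℓ = lookup-ext y (a [ k ]≔ lookup y k) entry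
  where
  entry : ∀ j → lookup y j ≡ lookup (a [ k ]≔ lookup y k) j
  entry j with j ≟ k
  ... | yes refl = sym (lookup∘update j a (lookup y j))
  ... | no j≢k   = trans (y∈ℓ j (x≢y⇒x∉⁅y⁆ j≢k)) (sym (lookup∘update′ j≢k a (lookup y k)))

meetsEveryLine⇒mds : ∀ {q d} {C : Code q d} → MeetsEveryLine C → IsMDS 1 C
meetsEveryLine⇒mds {C = C} lines S a ∣S∣≡1 with ∣p∣≡1⇒singleton S ∣S∣≡1
... | k , refl with lines k a
... | v , av∈C , unique =
  a [ k ]≔ v , (av∈C , update-onLine k a v) ,
  λ y y∈C y∈ℓ → trans (onLine⇒update y∈ℓ)
                      (cong (a [ k ]≔_) (sym (unique (subst C (onLine⇒update y∈ℓ) y∈C))))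

record IsLatinSquare {A : Set} (f : A → A → A) : Set where
  field
    solveˡ : ∀ b c → ∃! _≡_ (λ a → f a b ≡ c)
    solveʳ : ∀ a c → ∃! _≡_ (λ b → f a b ≡ c)

balanced : ∀ {q} (f g : Fin q → Fin q → Fin q) → Code q 4
balanced f g y = f (lookup y (# 1)) (lookup y (# 2)) ≡ g (lookup y (# 0)) (lookup y (# 3))

-- Along each line three entries are fixed, and the equation is solved
-- uniquely for the remaining one by the latin property of f or g.
balanced-lines : ∀ {q} {f g : Fin q → Fin q → Fin q} →
  IsLatinSquare f → IsLatinSquare g → MeetsEveryLine (balanced f g)
balanced-lines {f = f} {g} latin-f latin-g = lines
  where
  open IsLatinSquare
  lines : MeetsEveryLine (balanced f g)
  lines zero                   (a₀ ∷ a₁ ∷ a₂ ∷ a₃ ∷ []) = ∃!-map sym sym (solveˡ latin-g a₃ (f a₁ a₂))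
  lines (suc zero)             (a₀ ∷ a₁ ∷ a₂ ∷ a₃ ∷ []) = solveˡ latin-f a₂ (g a₀ a₃)
  lines (suc (suc zero))       (a₀ ∷ a₁ ∷ a₂ ∷ a₃ ∷ []) = solveʳ latin-f a₁ (g a₀ a₃)
  lines (suc (suc (suc zero))) (a₀ ∷ a₁ ∷ a₂ ∷ a₃ ∷ []) = ∃!-map sym sym (solveʳ latin-g a₀ (f a₁ a₂))

module SquaresOf {q d} {M : Code q d} (determined : TwoDetermined M) where

  codeword : {A B : Fin d} → A ≢ B → Fin q → Fin q → Word q d
  codeword A≢B va vb = proj₁ (determined A≢B va vb)

  square : {A B : Fin d} → A ≢ B → Fin d → Fin q → Fin q → Fin q
  square A≢B I va vb = lookup (codeword A≢B va vb) I

  square-spec : ∀ {A B : Fin d} (A≢B : A ≢ B) I {x} → M x →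
                square A≢B I (lookup x A) (lookup x B) ≡ lookup x I
  square-spec A≢B I x∈M =
    cong (λ z → lookup z I) (proj₂ (proj₂ (determined A≢B _ _)) (x∈M , refl , refl))

  square-swap : ∀ {A B : Fin d} (A≢B : A ≢ B) (B≢A : B ≢ A) I va vb →
                square A≢B I va vb ≡ square B≢A I vb va
  square-swap A≢B B≢A I va vb with determined A≢B va vb
  ... | x , (x∈M , xA , xB) , _ =
    sym (subst₂ (λ s t → square B≢A I s t ≡ lookup x I) xB xA (square-spec B≢A I x∈M))

  -- The square is solvable for its first argument: the solution is the
  -- A-entry of the codeword with entries vb at B and c at I.
  solve-first : ∀ {A B I : Fin d} (A≢B : A ≢ B) → B ≢ I → ∀ vb c →
                ∃! _≡_ (λ va → square A≢B I va vb ≡ c)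
  solve-first {A} {B} {I} A≢B B≢I vb c with determined B≢I vb c
  ... | w , (w∈M , wB , wI) , w-unique =
    lookup w A ,
    trans (cong (square A≢B I (lookup w A)) (sym wB)) (trans (square-spec A≢B I w∈M) wI) ,
    λ {va} square≡c →
      let y , (y∈M , yA , yB) , _ = determined A≢B va vb
      in trans (cong (λ z → lookup z A) (w-unique (y∈M , yB , square≡c))) yA

  -- For pairwise distinct A, B, I the square is latin; the second argument
  -- is handled by transposing.
  square-latin : ∀ {A B I : Fin d} (A≢B : A ≢ B) → A ≢ I → B ≢ I →
                 IsLatinSquare (square A≢B I)
  square-latin {A} {B} A≢B A≢I B≢I = record
    { solveˡ = solve-first A≢B B≢I
    ; solveʳ = λ va c → ∃!-map (λ e → trans (square-swap A≢B B≢A _ va _) e)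
                               (λ e → trans (sym (square-swap A≢B B≢A _ va _)) e)
                               (solve-first B≢A A≢I va c)
    }
    where
    B≢A : B ≢ A
    B≢A = A≢B ∘ sym

proposition4 : (q : ℕ) (M : Code q 5) → IsMDS 3 M → (i : Fin 5) →
    Σ (Code q 4) λ C → IsMDS 1 C × (projection i M ⊆ C)
proposition4 q M mds i =
  balanced f g ,
  meetsEveryLine⇒mds (balanced-lines (square-latin _ (e≢i _) (e≢i _))
                                     (square-latin _ (e≢i _) (e≢i _))) ,
  contains
  where
  open SquaresOf (mds⇒twoDetermined mds)
  -- Coordinate k of Q⁴ sits at position e k of Q⁵.
  e : Fin 4 → Fin 5
  e = punchIn i
  e≢i : ∀ k → e k ≢ i
  e≢i = punchInᵢ≢i i
  e-injective : ∀ {j k} → j ≢ k → e j ≢ e k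
  e-injective j≢k = j≢k ∘ punchIn-injective i _ _
  f g : Fin q → Fin q → Fin q
  f = square (e-injective {# 1} {# 2} (λ ())) i
  g = square (e-injective {# 0} {# 3} (λ ())) i
  -- Both sides of the defining equation equal the deleted entry x_i.
  contains : projection i M ⊆ balanced f g
  contains (x , x∈M , refl) = begin
    f (y (# 1)) (y (# 2)) ≡⟨ cong₂ f (lookup-removeAt x i _) (lookup-removeAt x i _) ⟩
    f (lookup x (e (# 1))) (lookup x (e (# 2))) ≡⟨ square-spec _ i x∈M ⟩
    lookup x i ≡⟨ sym (square-spec _ i x∈M) ⟩
    g (lookup x (e (# 0))) (lookup x (e (# 3))) ≡⟨ sym (cong₂ g (lookup-removeAt x i _) (lookup-removeAt x i _)) ⟩
    g (y (# 0)) (y (# 3)) ∎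
    where
    open ≡-Reasoning
    y : Fin 4 → Fin q
    y = lookup (removeAt x i)
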